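{- For every positive integer $h$, the set $\mathcal{R}_{\mathbf{Z}}(h,4)$ contains the $h$-term arithmetic progression $\{ bh + 1 : b \in [3, h+2] \}$.
   Context: For real numbers $u\le v$, $[u,v]$ denotes the integer interval $\{n\in\mathbf{Z}: u\le n\le v\}$. For a nonempty set $A$ of integers and a positive integer $h$, $hA$ denotes the set of all sums of $h$ not necessarily distinct elements of $A$. The sumset size set is $\mathcal{R}_{\mathbf{Z}}(h,k) = \{ |hA| : A \subseteq \mathbf{Z},\ |A| = k \}$. -}

module Defs where

open import Data.Nat using (ℕ)
open import Data.Integer using (ℤ; _+_; 0ℤ)
open import Data.Vec using (Vec; []; _∷_)
import Data.Vec.Relation.Unary.All as VAll
open import Data.List using (List; length)
open import Data.List.Membership.Propositional using (_∈_)
open import Data.List.Relation.Unary.Unique.Propositional using (Unique)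
open import Data.Product using (∃; _×_)
open import Function.Bundles using (_⇔_)
open import Relation.Binary.PropositionalEquality using (_≡_)

sumℤ : ∀ {n} → Vec ℤ n → ℤ
sumℤ []       = 0ℤ
sumℤ (x ∷ xs) = x + sumℤ xs

InSumset : ℕ → List ℤ → ℤ → Set
InSumset h A x = ∃ λ (xs : Vec ℤ h) → VAll.All (_∈ A) xs × sumℤ xs ≡ x

HasSize : (ℤ → Set) → ℕ → Set
HasSize P m = ∃ λ (L : List ℤ) → Unique L × (∀ x → (x ∈ L ⇔ P x)) × length L ≡ m

-- m ∈ R_Z(h,k): there is a k-element set A ⊆ ℤ with |hA| = m
-- (A is represented as a duplicate-free list of length k)
InR : ℕ → ℕ → ℕ → Set
InR h k m = ∃ λ (A : List ℤ) → Unique A × length A ≡ k × HasSize (InSumset h A) m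

{-# OPTIONS --safe #-}
module Submission where

-- With c = b − 1, take A = {0, 1, c, c + 1}. Each element is ε + c δ with
-- ε, δ ∈ {0, 1}, so hA = {i + c j : 0 ≤ i, j ≤ h}. Since 2 ≤ c ≤ h + 1, every
-- n ≤ h + c h has such a representation (take i = n mod c, j = n div c, or
-- j = h once n ≥ c h), hence hA = [0, (c + 1) h] has b h + 1 elements.

open import Defs
open import Data.Nat using (ℕ; zero; suc; _+_; _*_; _∸_; _≤_; _<_; _≤?_; z≤n; s≤s; NonZero)
open import Data.Nat.Properties
open import Data.Nat.DivMod using (_/_; _%_; m≡m%n+[m/n]*n; m%n<n; m<n*o⇒m/o<n)
open import Data.Nat.Tactic.RingSolver using (solve-∀)
open import Data.Integer using (ℤ; +_) renaming (_+_ to _ℤ+_)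
import Data.Integer.Properties as ℤ
open import Data.Vec using ([]; _∷_)
open import Data.Vec.Relation.Unary.All using (All; []; _∷_)
open import Data.List using (List; map; upTo; []; _∷_)
open import Data.List.Properties using (length-map; length-upTo)
open import Data.List.Membership.Propositional using (_∈_)
open import Data.List.Membership.Propositional.Properties using (∈-map⁺; ∈-map⁻; ∈-upTo⁺; ∈-upTo⁻)
open import Data.List.Relation.Unary.Any using (here; there)
import Data.List.Relation.Unary.All as List
open import Data.List.Relation.Unary.AllPairs using ([]; _∷_)
open import Data.List.Relation.Unary.Unique.Propositional using (Unique)
import Data.List.Relation.Unary.Unique.Propositional.Properties as Unique
open import Data.Product using (∃; ∃₂; _×_; _,_)
open import Function.Bundles using (Equivalence; _⇔_; mk⇔)
open import Function.Construct.Composition using (_⇔-∘_)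
open import Relation.Nullary using (yes; no)
open import Relation.Binary.PropositionalEquality using (_≡_; refl; sym; trans; cong; subst)

HasSize-interval : ∀ {P : ℤ → Set} N →
  (∀ x → P x ⇔ ∃ λ n → n ≤ N × x ≡ + n) → HasSize P (suc N)
HasSize-interval {P} N P⇔ =
  L , Unique.map⁺ ℤ.+-injective (Unique.upTo⁺ (suc N)) , ∈L⇔ ,
  trans (length-map +_ (upTo (suc N))) (length-upTo (suc N))
  where
  L : List ℤ
  L = map +_ (upTo (suc N))
  ∈L⇔ : ∀ x → x ∈ L ⇔ P x
  ∈L⇔ x = mk⇔ to from
    where
    to : x ∈ L → P x
    to x∈L with ∈-map⁻ +_ x∈L
    ... | n , n∈ , x≡n = Equivalence.from (P⇔ x) (n , m<1+n⇒m≤n (∈-upTo⁻ n∈) , x≡n)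
    from : P x → x ∈ L
    from Px with Equivalence.to (P⇔ x) Px
    ... | n , n≤N , refl = ∈-map⁺ +_ (∈-upTo⁺ (s≤s n≤N))

digitSet : ℕ → List ℤ
digitSet c = + 0 ∷ + 1 ∷ + c ∷ + suc c ∷ []

digitSet-unique : ∀ {c} → 2 ≤ c → Unique (digitSet c)
digitSet-unique (s≤s (s≤s _)) =
    ((λ ()) List.∷ (λ ()) List.∷ (λ ()) List.∷ List.[])
  ∷ ((λ ()) List.∷ (λ ()) List.∷ List.[])
  ∷ ((λ c≡1+c → 1+n≢n (sym (ℤ.+-injective c≡1+c))) List.∷ List.[])
  ∷ List.[] ∷ []

DigitSum : ℕ → ℕ → ℤ → Set
DigitSum c h x = ∃₂ λ i j → i ≤ h × j ≤ h × x ≡ + (i + c * j)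

digitSet⇔digit : ∀ c x → x ∈ digitSet c ⇔ DigitSum c 1 x
digitSet⇔digit c x = mk⇔ to from
  where
  to : x ∈ digitSet c → DigitSum c 1 x
  to (here refl)                         = 0 , 0 , z≤n , z≤n , cong +_ (sym (*-zeroʳ c))
  to (there (here refl))                 = 1 , 0 , ≤-refl , z≤n , cong (λ t → + suc t) (sym (*-zeroʳ c))
  to (there (there (here refl)))         = 0 , 1 , z≤n , ≤-refl , cong +_ (sym (*-identityʳ c))
  to (there (there (there (here refl)))) = 1 , 1 , ≤-refl , ≤-refl , cong (λ t → + suc t) (sym (*-identityʳ c))
  from : DigitSum c 1 x → x ∈ digitSet c
  from (0 , 0 , _ , _ , refl) rewrite *-zeroʳ c = here refl
  from (1 , 0 , _ , _ , refl) rewrite *-zeroʳ c = there (here refl)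
  from (0 , 1 , _ , _ , refl) rewrite *-identityʳ c = there (there (here refl))
  from (1 , 1 , _ , _ , refl) rewrite *-identityʳ c = there (there (there (here refl)))
  from (suc (suc _) , _ , s≤s () , _)
  from (_ , suc (suc _) , _ , s≤s () , _)

+-*-shuffle : ∀ c ε δ i j → (ε + c * δ) + (i + c * j) ≡ (ε + i) + c * (δ + j)
+-*-shuffle = solve-∀

≤-suc-split : ∀ {i h} → i ≤ suc h → ∃₂ λ ε i′ → ε ≤ 1 × i′ ≤ h × i ≡ ε + i′
≤-suc-split {zero}  _         = 0 , 0 , z≤n , z≤n , refl
≤-suc-split {suc i} (s≤s i≤h) = 1 , i , ≤-refl , i≤h , refl

DigitSum-zero : ∀ c → DigitSum c 0 (+ 0)
DigitSum-zero c = 0 , 0 , z≤n , z≤n , cong +_ (sym (*-zeroʳ c))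

DigitSum-+ : ∀ {c h x y} → DigitSum c 1 x → DigitSum c h y → DigitSum c (suc h) (x ℤ+ y)
DigitSum-+ {c} (ε , δ , ε≤1 , δ≤1 , refl) (i , j , i≤h , j≤h , refl) =
  ε + i , δ + j , +-mono-≤ ε≤1 i≤h , +-mono-≤ δ≤1 j≤h , cong +_ (+-*-shuffle c ε δ i j)

DigitSum-split : ∀ {c h x} → DigitSum c (suc h) x →
  ∃₂ λ y z → DigitSum c 1 y × DigitSum c h z × x ≡ y ℤ+ z
DigitSum-split {c} (i , j , i≤ , j≤ , refl)
  with ≤-suc-split i≤ | ≤-suc-split j≤
... | ε , i′ , ε≤1 , i′≤h , refl | δ , j′ , δ≤1 , j′≤h , refl =
  + (ε + c * δ) , + (i′ + c * j′) ,
  (ε , δ , ε≤1 , δ≤1 , refl) , (i′ , j′ , i′≤h , j′≤h , refl) ,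
  cong +_ (sym (+-*-shuffle c ε δ i′ j′))

InSumset⇔DigitSum : ∀ c h x → InSumset h (digitSet c) x ⇔ DigitSum c h x
InSumset⇔DigitSum c h x = mk⇔ (to h) (from h)
  where
  to : ∀ h {x} → InSumset h (digitSet c) x → DigitSum c h x
  to zero    ([] , [] , refl) = DigitSum-zero c
  to (suc h) (y ∷ ys , y∈ ∷ ys∈ , refl) =
    DigitSum-+ {c} (Equivalence.to (digitSet⇔digit c y) y∈) (to h (ys , ys∈ , refl))
  from : ∀ h {x} → DigitSum c h x → InSumset h (digitSet c) x
  from zero    (zero , zero , _ , _ , refl) = [] , [] , cong +_ (sym (*-zeroʳ c))
  from (suc h) x∈ with DigitSum-split {c} x∈
  ... | y , z , y∈ , z∈ , refl with from h z∈
  ... | zs , zs∈ , refl = y ∷ zs , Equivalence.from (digitSet⇔digit c y) y∈ ∷ zs∈ , refl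

DigitSum⇔interval : ∀ {c h} .{{_ : NonZero c}} → c ≤ suc h →
  ∀ x → DigitSum c h x ⇔ ∃ λ n → n ≤ h + c * h × x ≡ + n
DigitSum⇔interval {c} {h} c≤1+h x = mk⇔ to from
  where
  to : DigitSum c h x → ∃ λ n → n ≤ h + c * h × x ≡ + n
  to (i , j , i≤h , j≤h , x≡) = i + c * j , +-mono-≤ i≤h (*-monoʳ-≤ c j≤h) , x≡
  from : (∃ λ n → n ≤ h + c * h × x ≡ + n) → DigitSum c h x
  from (n , n≤ , refl) with c * h ≤? n
  ... | yes ch≤n = n ∸ c * h , h , m≤n+o⇒m∸n≤o n (c * h) (subst (n ≤_) (+-comm h (c * h)) n≤) ,
                   ≤-refl , cong +_ (sym (m∸n+n≡m ch≤n))
  ... | no  ch≰n = n % c , n / c , m<1+n⇒m≤n (≤-trans (m%n<n n c) c≤1+h) ,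
                   <⇒≤ (m<n*o⇒m/o<n (subst (n <_) (*-comm c h) (≰⇒> ch≰n))) ,
                   cong +_ (trans (m≡m%n+[m/n]*n n c) (cong (λ m → n % c + m) (*-comm (n / c) c)))

-- The hypothesis 1 ≤ h is redundant: 3 ≤ b ≤ h + 2 already forces it.
mainTheorem4 : (h : ℕ) → 1 ≤ h → (b : ℕ) → 3 ≤ b → b ≤ h + 2 →
    InR h 4 (b * h + 1)
mainTheorem4 h _ b@(suc c) (s≤s 2≤c@(s≤s _)) b≤h+2 =
  digitSet c , digitSet-unique 2≤c , refl ,
  subst (HasSize (InSumset h (digitSet c))) (+-comm 1 (b * h))
    (HasSize-interval (b * h) λ x → DigitSum⇔interval c≤1+h x ⇔-∘ InSumset⇔DigitSum c h x)
  where
  c≤1+h : c ≤ suc h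
  c≤1+h = ≤-pred (subst (b ≤_) (+-comm h 2) b≤h+2)
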